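{- There are infinitely many (pairwise non-isomorphic) vertex-transitive digraphs that are not isomorphic to the Cayley digraph $\mathrm{Cay}(S,C)$ of any semigroup $S$ with any $C\subseteq S$.
   Context: For a semigroup $S$ and $C\subseteq S$, the Cayley digraph $\mathrm{Cay}(S,C)$ has vertex set $S$ and one arc $(s,sc)$ for each $s\in S$, $c\in C$. A digraph is vertex-transitive if its automorphism group acts transitively on its vertices. -}

module Defs where

open import Level using (Level; suc; _⊔_)
open import Data.Product using (Σ; ∃; _×_; _,_)
open import Function.Bundles using (_↔_; Inverse; _⇔_)
open import Relation.Binary.PropositionalEquality using (_≡_)

-- A digraph (loops allowed, no multiple arcs): a vertex set together with
-- an arc relation.  E u v is inhabited iff there is an arc (u , v).
record Digraph : Set₁ where
  field
    V : Set
    E : V → V → Set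

open Digraph public

record _≅_ (D D' : Digraph) : Set where
  field
    vmap  : V D ↔ V D'
    arcs  : ∀ u v → E D u v ⇔ E D' (Inverse.to vmap u) (Inverse.to vmap v)

Aut : Digraph → Set
Aut D = D ≅ D

VertexTransitive : Digraph → Set
VertexTransitive D =
  ∀ (u v : V D) → Σ (Aut D) (λ φ → Inverse.to (_≅_.vmap φ) u ≡ v)

record Semigroup : Set₁ where
  field
    Carrier : Set
    _∙_     : Carrier → Carrier → Carrier
    assoc   : ∀ x y z → ((x ∙ y) ∙ z) ≡ (x ∙ (y ∙ z))

Cay : (S : Semigroup) → (Semigroup.Carrier S → Set) → Digraph
Cay S C = record
  { V = Carrier
  ; E = λ s t → Σ Carrier (λ c → C c × ((s ∙ c) ≡ t))
  }
  where open Semigroup S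

IsSemigroupCayley : Digraph → Set₁
IsSemigroupCayley D =
  Σ Semigroup (λ S → Σ (Semigroup.Carrier S → Set) (λ C → D ≅ Cay S C))

{-# OPTIONS --safe #-}
-- Take vertices ℤ × B, where B is the group of finitely supported bit
-- sequences under XOR, and arcs (n , w ≫ (j + 1)) → (n + 1 , w), where ≫
-- drops the lowest bits. Every vertex has exactly one in-neighbour and
-- exactly 2 ^ (j + 1) out-neighbours, so these digraphs are pairwise
-- non-isomorphic. They are vertex-transitive: shifting levels by a and
-- XOR-ing level n by g n is an automorphism whenever (g (n + 1)) ≫ (j + 1)
-- = g n, and such g can take any prescribed value at any level. In a
-- semigroup Cayley digraph, however, unique in-neighbours force every
-- vertex to have at most one out-neighbour.
module Submission where

open import Defs
open import Data.Nat using (ℕ)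
open import Data.Product using (Σ; _×_)
open import Relation.Nullary using (¬_)
open import Relation.Binary.PropositionalEquality using (_≡_)

open import Algebra.Core using (Op₂)
open import Data.Bool using (Bool; true; false; not; _xor_)
open import Data.Bool.Properties using (xor-comm; xor-assoc; xor-same; xor-identityʳ)
open import Data.Fin using (Fin; combine; remQuot; inject≤)
import Data.Fin.Properties as FinP
open import Data.Integer using (ℤ; +_; -[1+_]; 0ℤ; 1ℤ; _+_; _-_)
import Data.Integer as ℤ
import Data.Integer.Properties as ℤP
open import Algebra.Properties.AbelianGroup ℤP.+-0-abelianGroup
  using (//-rightDividesˡ; //-rightDividesʳ; ∙-cancelʳ)
open import Data.Nat using (zero; suc; _^_; _≤_; _<_; s≤s; z≤n)
import Data.Nat.Properties as ℕP
open import Data.Nat.GeneralisedArithmetic using (fold; iterate)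
open import Data.Product using (_,_; proj₁; proj₂; uncurry)
open import Function using (_∘_)
open import Function.Bundles using (_↔_; Inverse; Equivalence; Injection; mk↔ₛ′; mk⇔)
open import Function.Definitions using (Injective)
open import Function.Properties.Inverse using (↔⇒↣)
open import Relation.Binary.Definitions using (tri<; tri≈; tri>)
open import Relation.Binary.PropositionalEquality
  using (refl; sym; trans; cong; cong₂; subst₂; module ≡-Reasoning)

-- Isomorphism invariants

≅-sym : ∀ {D D′} → D ≅ D′ → D′ ≅ D
≅-sym {D} {D′} φ = record
  { vmap = mk↔ₛ′ from to strictlyInverseʳ strictlyInverseˡ
  ; arcs = λ u v → mk⇔
      (λ e → Equivalence.from (arcs (from u) (from v))
               (subst₂ (E D′) (sym (strictlyInverseˡ u)) (sym (strictlyInverseˡ v)) e))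
      (λ e → subst₂ (E D′) (strictlyInverseˡ u) (strictlyInverseˡ v)
               (Equivalence.to (arcs (from u) (from v)) e))
  }
  where
  open _≅_ φ
  open Inverse vmap

module _ {D D′ : Digraph} (φ : D ≅ D′) where
  open Inverse (_≅_.vmap φ)

  arc-to : ∀ {u v} → E D u v → E D′ (to u) (to v)
  arc-to = Equivalence.to (_≅_.arcs φ _ _)

  to-injective : Injective _≡_ _≡_ to
  to-injective = Injection.injective (↔⇒↣ (_≅_.vmap φ))

OutDegreeAtLeast : ℕ → Digraph → Set
OutDegreeAtLeast K D =
  Σ (V D) λ v → Σ (Fin K → V D) λ f → (∀ i → E D v (f i)) × Injective _≡_ _≡_ f

UniqueInNeighbour : Digraph → Set
UniqueInNeighbour D = ∀ t → Σ (V D) λ s → E D s t × (∀ s′ → E D s′ t → s′ ≡ s)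

in-neighbour-unique : ∀ {D} → UniqueInNeighbour D → ∀ {s s′ t} → E D s t → E D s′ t → s ≡ s′
in-neighbour-unique uniq {t = t} e e′ =
  trans (proj₂ (proj₂ (uniq t)) _ e) (sym (proj₂ (proj₂ (uniq t)) _ e′))

outDegreeAtLeast-transport : ∀ {K D D′} → D ≅ D′ → OutDegreeAtLeast K D → OutDegreeAtLeast K D′
outDegreeAtLeast-transport φ (v , f , out , inj) =
  to v , to ∘ f , arc-to φ ∘ out , inj ∘ to-injective φ
  where open Inverse (_≅_.vmap φ)

outDegreeAtLeast-mono : ∀ {K L D} → K ≤ L → OutDegreeAtLeast L D → OutDegreeAtLeast K D
outDegreeAtLeast-mono K≤L (v , f , out , inj) =
  v , f ∘ (λ i → inject≤ i K≤L) , out ∘ (λ i → inject≤ i K≤L) ,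
  FinP.inject≤-injective K≤L K≤L _ _ ∘ inj

uniqueInNeighbour-transport : ∀ {D D′} → D ≅ D′ → UniqueInNeighbour D → UniqueInNeighbour D′
uniqueInNeighbour-transport {D} {D′} φ uniq t = to s , arc , unique
  where
  open Inverse (_≅_.vmap φ)
  s : V D
  s = proj₁ (uniq (from t))
  arc : E D′ (to s) t
  arc = subst₂ (E D′) refl (strictlyInverseˡ t) (arc-to φ (proj₁ (proj₂ (uniq (from t)))))
  unique : ∀ s′ → E D′ s′ t → s′ ≡ to s
  unique s′ e = begin
    s′             ≡⟨ strictlyInverseˡ s′ ⟨
    to (from s′)   ≡⟨ cong to (proj₂ (proj₂ (uniq (from t))) (from s′) (arc-to (≅-sym φ) e)) ⟩
    to s           ∎
    where open ≡-Reasoning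

-- Semigroup Cayley digraphs

-- If every vertex of Cay(S,C) has exactly one in-neighbour, then the
-- in-neighbour of c ∈ C is a right identity q, and the in-neighbour of q
-- is an r with x = (x ∙ r) ∙ d′ for all x (some d′ ∈ C); so x ∙ r is the
-- in-neighbour of x and every out-neighbour of v equals v ∙ d′.
cay-outNeighbour-unique :
  ∀ S C → UniqueInNeighbour (Cay S C) →
  ∀ {v w w′} → E (Cay S C) v w → E (Cay S C) v w′ → w ≡ w′
cay-outNeighbour-unique S C uniq {v} (c , c∈C , refl) (c′ , c′∈C , refl) =
  trans (child≡ c c∈C) (sym (child≡ c′ c′∈C))
  where
  open Semigroup S
  open ≡-Reasoning
  parent : ∀ {s s′ t} → E (Cay S C) s t → E (Cay S C) s′ t → s ≡ s′
  parent = in-neighbour-unique {Cay S C} uniq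
  q r : Carrier
  q = proj₁ (uniq c)
  r = proj₁ (uniq q)
  qd≡c : E (Cay S C) q c
  qd≡c = proj₁ (proj₂ (uniq c))
  rd≡q : E (Cay S C) r q
  rd≡q = proj₁ (proj₂ (uniq q))
  d′ : Carrier
  d′ = proj₁ rd≡q

  q-identityʳ : ∀ x → x ∙ q ≡ x
  q-identityʳ x = parent {t = x ∙ c}
    (proj₁ qd≡c , proj₁ (proj₂ qd≡c) , trans (assoc x q _) (cong (x ∙_) (proj₂ (proj₂ qd≡c))))
    (c , c∈C , refl)

  r-arc : ∀ x → (x ∙ r) ∙ d′ ≡ x
  r-arc x = begin
    (x ∙ r) ∙ d′  ≡⟨ assoc x r d′ ⟩
    x ∙ (r ∙ d′)  ≡⟨ cong (x ∙_) (proj₂ (proj₂ rd≡q)) ⟩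
    x ∙ q         ≡⟨ q-identityʳ x ⟩
    x             ∎

  child≡ : ∀ c → C c → v ∙ c ≡ v ∙ d′
  child≡ c c∈C = begin
    v ∙ c                ≡⟨ r-arc (v ∙ c) ⟨
    ((v ∙ c) ∙ r) ∙ d′   ≡⟨ cong (_∙ d′) (parent (d′ , proj₁ (proj₂ rd≡q) , r-arc (v ∙ c)) (c , c∈C , refl)) ⟩
    v ∙ d′               ∎

¬semigroupCayley : ∀ D → UniqueInNeighbour D → OutDegreeAtLeast 2 D → ¬ IsSemigroupCayley D
¬semigroupCayley D uniq outDeg (S , C , φ) with outDegreeAtLeast-transport φ outDeg
... | v , f , out , inj
    with inj (cay-outNeighbour-unique S C (uniqueInNeighbour-transport φ uniq)
                (out Fin.zero) (out (Fin.suc Fin.zero)))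
...   | ()

-- Towers

tower : {X : Set} → (X → X) → Digraph
tower {X} π = record
  { V = ℤ × X
  ; E = λ u v → proj₁ v ≡ ℤ.suc (proj₁ u) × π (proj₂ v) ≡ proj₂ u
  }

tower-uniqueInNeighbour : ∀ {X} (π : X → X) → UniqueInNeighbour (tower π)
tower-uniqueInNeighbour π (m , y) = (ℤ.pred m , π y) , (sym (ℤP.suc-pred m) , refl) , unique
  where
  unique : ∀ s → E (tower π) s (m , y) → s ≡ (ℤ.pred m , π y)
  unique (n , x) (m≡1+n , πy≡x) =
    cong₂ _,_ (trans (sym (ℤP.pred-suc n)) (cong ℤ.pred (sym m≡1+n))) (sym πy≡x)

module TowerTranslation
  {X : Set} (_⊕_ : Op₂ X)
  (⊕-comm : ∀ x y → x ⊕ y ≡ y ⊕ x)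
  (⊕-cancelʳ : ∀ x y → (x ⊕ y) ⊕ y ≡ x)
  (π : X → X) (π-⊕ : ∀ x y → π (x ⊕ y) ≡ π x ⊕ π y)
  (σ : X → X) (π∘σ : ∀ x → π (σ x) ≡ x)
  where

  Thread : Set
  Thread = Σ (ℤ → X) λ g → ∀ k → π (g (ℤ.suc k)) ≡ g k

  threadFromZero : X → ℤ → X
  threadFromZero d (+ n)    = fold d σ n
  threadFromZero d -[1+ n ] = fold (π d) π n

  threadFromZero-coherent : ∀ d k → π (threadFromZero d (ℤ.suc k)) ≡ threadFromZero d k
  threadFromZero-coherent d (+ n)          = π∘σ (fold d σ n)
  threadFromZero-coherent d -[1+ zero ]    = refl
  threadFromZero-coherent d -[1+ suc n ]   = refl

  thread : ℤ → X → Thread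
  thread n₀ d = (λ k → threadFromZero d (k - n₀)) , λ k →
    trans (cong (π ∘ threadFromZero d) (ℤP.+-assoc 1ℤ k (ℤ.- n₀))) (threadFromZero-coherent d (k - n₀))

  thread-at : ∀ n₀ d → proj₁ (thread n₀ d) n₀ ≡ d
  thread-at n₀ d = cong (threadFromZero d) (ℤP.+-inverseʳ n₀)

  translate : ℤ → Thread → Aut (tower π)
  translate a (g , coherent) = record
    { vmap = mk↔ₛ′ to from to∘from from∘to
    ; arcs = λ u v → mk⇔ (forward u v) (backward u v)
    }
    where
    to from : ℤ × X → ℤ × X
    to   (n , x) = n + a , x ⊕ g n
    from (m , y) = m - a , y ⊕ g (m - a)
    to∘from : ∀ u → to (from u) ≡ u
    to∘from (m , y) = cong₂ _,_ (//-rightDividesˡ a m) (⊕-cancelʳ y _)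
    from∘to : ∀ u → from (to u) ≡ u
    from∘to (n , x) =
      trans (cong (λ k → k , (x ⊕ g n) ⊕ g k) (//-rightDividesʳ a n)) (cong (n ,_) (⊕-cancelʳ x (g n)))
    forward : ∀ u v → E (tower π) u v → E (tower π) (to u) (to v)
    forward (n , x) (m , y) (refl , refl) =
      ℤP.+-assoc 1ℤ n a , trans (π-⊕ y _) (cong (π y ⊕_) (coherent n))
    backward : ∀ u v → E (tower π) (to u) (to v) → E (tower π) u v
    backward (n , x) (m , y) (m+a≡1+n+a , πy⊕gm≡x⊕gn) = m≡1+n , πy≡x
      where
      open ≡-Reasoning
      m≡1+n : m ≡ ℤ.suc n
      m≡1+n = ∙-cancelʳ a m (ℤ.suc n) (trans m+a≡1+n+a (sym (ℤP.+-assoc 1ℤ n a)))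
      πy≡x : π y ≡ x
      πy≡x = begin
        π y                          ≡⟨ ⊕-cancelʳ (π y) (g n) ⟨
        (π y ⊕ g n) ⊕ g n            ≡⟨ cong (λ h → (π y ⊕ h) ⊕ g n) (coherent n) ⟨
        (π y ⊕ π (g (ℤ.suc n))) ⊕ g n ≡⟨ cong (_⊕ g n) (π-⊕ y _) ⟨
        π (y ⊕ g (ℤ.suc n)) ⊕ g n    ≡⟨ cong (λ k → π (y ⊕ g k) ⊕ g n) m≡1+n ⟨
        π (y ⊕ g m) ⊕ g n            ≡⟨ cong (_⊕ g n) πy⊕gm≡x⊕gn ⟩
        (x ⊕ g n) ⊕ g n              ≡⟨ ⊕-cancelʳ x (g n) ⟩
        x                            ∎

  tower-vertexTransitive : VertexTransitive (tower π)
  tower-vertexTransitive (n , x) (m , y) =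
    translate (m - n) (thread n (y ⊕ x)) ,
    cong₂ _,_ (trans (ℤP.+-comm n (m - n)) (//-rightDividesˡ n m))
              (trans (cong (x ⊕_) (thread-at n (y ⊕ x))) (trans (⊕-comm x (y ⊕ x)) (⊕-cancelʳ y x)))

module _ {X : Set} {m : ℕ} (split : X ↔ (Fin m × X)) where
  open Inverse split

  digit : X → Fin m
  digit = proj₁ ∘ to

  tower-outDegreeAtLeast : X → OutDegreeAtLeast m (tower (proj₂ ∘ to))
  tower-outDegreeAtLeast x₀ = (0ℤ , x₀) , child , child-arc , child-injective
    where
    child : Fin m → ℤ × X
    child c = 1ℤ , from (c , x₀)
    child-arc : ∀ c → E (tower (proj₂ ∘ to)) (0ℤ , x₀) (child c)
    child-arc c = refl , cong proj₂ (strictlyInverseˡ (c , x₀))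
    child-injective : Injective _≡_ _≡_ child
    child-injective {c} {c′} eq = begin
      c                        ≡⟨ cong proj₁ (strictlyInverseˡ (c , x₀)) ⟨
      digit (from (c , x₀))    ≡⟨ cong (digit ∘ proj₂) eq ⟩
      digit (from (c′ , x₀))   ≡⟨ cong proj₁ (strictlyInverseˡ (c′ , x₀)) ⟩
      c′                       ∎
      where open ≡-Reasoning

  tower-outNeighbour-by-digit :
    ∀ {v u u′} → E (tower (proj₂ ∘ to)) v u → E (tower (proj₂ ∘ to)) v u′ →
    digit (proj₂ u) ≡ digit (proj₂ u′) → u ≡ u′
  tower-outNeighbour-by-digit (n≡ , πy≡) (n′≡ , πy′≡) same-digit =
    cong₂ _,_ (trans n≡ (sym n′≡))
      (Injection.injective (↔⇒↣ split) (cong₂ _,_ same-digit (trans πy≡ (sym πy′≡))))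

  tower-¬outDegreeAtLeast : ∀ {K} → m < K → ¬ OutDegreeAtLeast K (tower (proj₂ ∘ to))
  tower-¬outDegreeAtLeast m<K (v , f , out , inj)
    with FinP.pigeonhole m<K (digit ∘ proj₂ ∘ f)
  ... | i , j , i<j , same-digit =
    FinP.<⇒≢ i<j (inj (tower-outNeighbour-by-digit {v = v} (out i) (out j) same-digit))

-- Finitely supported bit sequences

-- Least significant bit first; as binary numerals without leading zeros,
-- equal sequences are equal terms.
data Pos : Set where
  one     : Pos
  _·0 _·1 : Pos → Pos

data Bits : Set where
  zeros : Bits
  pos   : Pos → Bits

cons : Bool → Bits → Bits
cons false zeros   = zeros
cons true  zeros   = pos one
cons false (pos q) = pos (q ·0)
cons true  (pos q) = pos (q ·1)

low : Bits → Bool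
low zeros         = false
low (pos one)     = true
low (pos (q ·0))  = false
low (pos (q ·1))  = true

half : Bits → Bits
half zeros        = zeros
half (pos one)    = zeros
half (pos (q ·0)) = pos q
half (pos (q ·1)) = pos q

cons-low-half : ∀ x → cons (low x) (half x) ≡ x
cons-low-half zeros        = refl
cons-low-half (pos one)    = refl
cons-low-half (pos (q ·0)) = refl
cons-low-half (pos (q ·1)) = refl

low-cons : ∀ b x → low (cons b x) ≡ b
low-cons false zeros   = refl
low-cons true  zeros   = refl
low-cons false (pos q) = refl
low-cons true  (pos q) = refl

half-cons : ∀ b x → half (cons b x) ≡ x
half-cons false zeros   = refl
half-cons true  zeros   = refl
half-cons false (pos q) = refl
half-cons true  (pos q) = refl

half-induction : (P : Bits → Set) → P zeros → (∀ x → P (half x) → P x) → ∀ x → P x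
half-induction P base step zeros   = base
half-induction P base step (pos q) = go q
  where
  go : ∀ q → P (pos q)
  go one    = step (pos one) base
  go (q ·0) = step (pos (q ·0)) (go q)
  go (q ·1) = step (pos (q ·1)) (go q)

xorPos : Pos → Bits → Bits
xorPos one    y = cons (not (low y)) (half y)
xorPos (q ·0) y = cons (low y) (xorPos q (half y))
xorPos (q ·1) y = cons (not (low y)) (xorPos q (half y))

infixl 6 _⊕_
_⊕_ : Bits → Bits → Bits
zeros ⊕ y = y
pos q ⊕ y = xorPos q y

⊕-unfold : ∀ x y → x ⊕ y ≡ cons (low x xor low y) (half x ⊕ half y)
⊕-unfold zeros        y = sym (cons-low-half y)
⊕-unfold (pos one)    y = refl
⊕-unfold (pos (q ·0)) y = refl
⊕-unfold (pos (q ·1)) y = refl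

low-⊕ : ∀ x y → low (x ⊕ y) ≡ low x xor low y
low-⊕ x y = trans (cong low (⊕-unfold x y)) (low-cons _ _)

half-⊕ : ∀ x y → half (x ⊕ y) ≡ half x ⊕ half y
half-⊕ x y = trans (cong half (⊕-unfold x y)) (half-cons _ _)

⊕-identityʳ : ∀ x → x ⊕ zeros ≡ x
⊕-identityʳ = half-induction (λ x → x ⊕ zeros ≡ x) refl λ x ih →
  trans (⊕-unfold x zeros) (trans (cong₂ cons (xor-identityʳ (low x)) ih) (cons-low-half x))

⊕-self : ∀ x → x ⊕ x ≡ zeros
⊕-self = half-induction (λ x → x ⊕ x ≡ zeros) refl λ x ih →
  trans (⊕-unfold x x) (cong₂ cons (xor-same (low x)) ih)

⊕-comm : ∀ x y → x ⊕ y ≡ y ⊕ x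
⊕-comm = half-induction (λ x → ∀ y → x ⊕ y ≡ y ⊕ x) (λ y → sym (⊕-identityʳ y)) λ x ih y →
  trans (⊕-unfold x y) (trans (cong₂ cons (xor-comm (low x) (low y)) (ih (half y))) (sym (⊕-unfold y x)))

⊕-cancelʳ : ∀ x y → x ⊕ y ⊕ y ≡ x
⊕-cancelʳ = half-induction (λ x → ∀ y → x ⊕ y ⊕ y ≡ x) ⊕-self λ x ih y → begin
  x ⊕ y ⊕ y                                            ≡⟨ ⊕-unfold (x ⊕ y) y ⟩
  cons (low (x ⊕ y) xor low y) (half (x ⊕ y) ⊕ half y) ≡⟨ cong₂ cons (cong (_xor low y) (low-⊕ x y))
                                                                      (cong (_⊕ half y) (half-⊕ x y)) ⟩
  cons ((low x xor low y) xor low y) (half x ⊕ half y ⊕ half y)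
      ≡⟨ cong₂ cons (trans (xor-assoc (low x) (low y) (low y))
                           (trans (cong (low x xor_) (xor-same (low y))) (xor-identityʳ (low x))))
                    (ih (half y)) ⟩
  cons (low x) (half x)                                ≡⟨ cons-low-half x ⟩
  x                                                    ∎
  where open ≡-Reasoning

halves : ℕ → Bits → Bits
halves k x = iterate half x k

doubles : ℕ → Bits → Bits
doubles k x = fold x (cons false) k

halves-⊕ : ∀ k x y → halves k (x ⊕ y) ≡ halves k x ⊕ halves k y
halves-⊕ zero    x y = refl
halves-⊕ (suc k) x y = trans (cong (halves k) (half-⊕ x y)) (halves-⊕ k (half x) (half y))

halves-doubles : ∀ k x → halves k (doubles k x) ≡ x
halves-doubles zero    x = refl
halves-doubles (suc k) x = trans (cong (halves k) (half-cons false (doubles k x))) (halves-doubles k x)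

lowBits : ∀ k → Bits → Fin (2 ^ k)
lowBits zero    w = Fin.zero
lowBits (suc k) w = combine {2} (Inverse.from FinP.2↔Bool (low w)) (lowBits k (half w))

pushLow : ∀ k → Fin (2 ^ k) → Bits → Bits
pushLow zero    c x = x
pushLow (suc k) c x =
  cons (Inverse.to FinP.2↔Bool (proj₁ (remQuot {2} (2 ^ k) c)))
       (pushLow k (proj₂ (remQuot {2} (2 ^ k) c)) x)

halves-pushLow : ∀ k c x → halves k (pushLow k c x) ≡ x
halves-pushLow zero    c x = refl
halves-pushLow (suc k) c x = trans (cong (halves k) (half-cons _ _)) (halves-pushLow k _ x)

lowBits-pushLow : ∀ k c x → lowBits k (pushLow k c x) ≡ c
lowBits-pushLow zero    Fin.zero x = refl
lowBits-pushLow (suc k) c        x = begin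
  lowBits (suc k) (pushLow (suc k) c x)  ≡⟨ cong₂ (combine {2}) low-digit high-digits ⟩
  combine (proj₁ qr) (proj₂ qr)          ≡⟨ FinP.combine-remQuot {2} (2 ^ k) c ⟩
  c                                      ∎
  where
  open ≡-Reasoning
  qr : Fin 2 × Fin (2 ^ k)
  qr = remQuot {2} (2 ^ k) c
  low-digit : Inverse.from FinP.2↔Bool (low (pushLow (suc k) c x)) ≡ proj₁ qr
  low-digit = trans (cong (Inverse.from FinP.2↔Bool) (low-cons _ _)) (Inverse.strictlyInverseʳ FinP.2↔Bool _)
  high-digits : lowBits k (half (pushLow (suc k) c x)) ≡ proj₂ qr
  high-digits = trans (cong (lowBits k) (half-cons _ _)) (lowBits-pushLow k _ x)

pushLow-lowBits : ∀ k w → pushLow k (lowBits k w) (halves k w) ≡ w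
pushLow-lowBits zero    w = refl
pushLow-lowBits (suc k) w = begin
  pushLow (suc k) (lowBits (suc k) w) (halves (suc k) w)
      ≡⟨ cong (λ qr → cons (Inverse.to FinP.2↔Bool (proj₁ qr)) (pushLow k (proj₂ qr) (halves k (half w))))
              (FinP.remQuot-combine {2} {2 ^ k} _ _) ⟩
  cons (Inverse.to FinP.2↔Bool (Inverse.from FinP.2↔Bool (low w)))
       (pushLow k (lowBits k (half w)) (halves k (half w)))
      ≡⟨ cong₂ cons (Inverse.strictlyInverseˡ FinP.2↔Bool (low w)) (pushLow-lowBits k (half w)) ⟩
  cons (low w) (half w)
      ≡⟨ cons-low-half w ⟩
  w   ∎
  where open ≡-Reasoning

splitLow : ∀ k → Bits ↔ (Fin (2 ^ k) × Bits)
splitLow k = mk↔ₛ′ (λ w → lowBits k w , halves k w) (uncurry (pushLow k))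
  (λ (c , x) → cong₂ _,_ (lowBits-pushLow k c x) (halves-pushLow k c x))
  (pushLow-lowBits k)

binaryTower : ℕ → Digraph
binaryTower j = tower (halves (suc j))

binaryTower-vertexTransitive : ∀ j → VertexTransitive (binaryTower j)
binaryTower-vertexTransitive j =
  TowerTranslation.tower-vertexTransitive _⊕_ ⊕-comm ⊕-cancelʳ
    (halves (suc j)) (halves-⊕ (suc j)) (doubles (suc j)) (halves-doubles (suc j))

binaryTower-outDegreeAtLeast : ∀ j → OutDegreeAtLeast (2 ^ suc j) (binaryTower j)
binaryTower-outDegreeAtLeast j = tower-outDegreeAtLeast (splitLow (suc j)) zeros

binaryTower-¬outDegreeAtLeast : ∀ i j → i < j → ¬ OutDegreeAtLeast (2 ^ suc j) (binaryTower i)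
binaryTower-¬outDegreeAtLeast i j i<j =
  tower-¬outDegreeAtLeast (splitLow (suc i)) (ℕP.^-monoʳ-< 2 (s≤s (s≤s z≤n)) (s≤s i<j))

binaryTower-≇ : ∀ i j → ¬ i ≡ j → ¬ binaryTower i ≅ binaryTower j
binaryTower-≇ i j i≢j φ with ℕP.<-cmp i j
... | tri< i<j _ _ = binaryTower-¬outDegreeAtLeast i j i<j
                       (outDegreeAtLeast-transport (≅-sym φ) (binaryTower-outDegreeAtLeast j))
... | tri≈ _ i≡j _ = i≢j i≡j
... | tri> _ _ j<i = binaryTower-¬outDegreeAtLeast j i j<i
                       (outDegreeAtLeast-transport φ (binaryTower-outDegreeAtLeast i))

corollary3p5 : Σ (ℕ → Digraph) (λ D →
                 ((i j : ℕ) → ¬ (i ≡ j) → ¬ (D i ≅ D j))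
                 × ((i : ℕ) → VertexTransitive (D i) × ¬ IsSemigroupCayley (D i)))
corollary3p5 = binaryTower , binaryTower-≇ , λ j →
  binaryTower-vertexTransitive j ,
  ¬semigroupCayley (binaryTower j) (tower-uniqueInNeighbour (halves (suc j)))
    (outDegreeAtLeast-mono {D = binaryTower j} (ℕP.^-monoʳ-≤ 2 {1} {suc j} (s≤s z≤n))
      (binaryTower-outDegreeAtLeast j))
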